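{- Let $P$ be an mca-program. If $M \subseteq \mathit{At}$ is a stable model of $P$, then $M$ is a supported model of $P$.
   Context: Let $\mathit{At}$ be a set of propositional atoms. An mc-atom over $\mathit{At}$ is an expression $kX$, where $k$ is a non-negative integer and $X \subseteq \mathit{At}$ is finite with $k \leq |X|$; $\mathit{aset}(kX) = X$. An mc-literal is $A$ or $\mathbf{not}(A)$ for an mc-atom $A$. An mca-clause $r$ is an expression $H \leftarrow L_1, \ldots, L_m$ ($m \geq 0$), where $H$ is an mc-atom and the $L_i$ are mc-literals, with $\mathit{hd}(r) = H$, $\mathit{bd}(r) = \{L_1, \ldots, L_m\}$, and $\mathit{hset}(r) = \mathit{aset}(H)$. An mca-program is a set of mca-clauses. It is Horn if no clause body contains a literal of the form $\mathbf{not}(A)$. For a set $Q$ of clauses, $\mathit{hset}(Q) = \bigcup\{\mathit{hset}(r) : r \in Q\}$. Satisfaction, for $M \subseteq \mathit{At}$: - $M \models kX$ iff $|M \cap X| \geq k$. - $M \models \mathbf{not}(kX)$ iff $|M \cap X| < k$. - $M \models \mathit{bd}(r)$ iff $M$ satisfies all literals of $\mathit{bd}(r)$. Operators, supported models, computations and derivable models: - $P(M) = \{r \in P : M \models \mathit{bd}(r)\}$. - $T^{\mathit{nd}}_P(M)$ is the set of all $M'$ with $M' \subseteq \mathit{hset}(P(M))$ and $M' \models \mathit{hd}(r)$ for all $r \in P(M)$. - $M$ is a supported model of $P$ if $M \in T^{\mathit{nd}}_P(M)$. - For a Horn mca-program $Q$, a $Q$-computation is a sequence $(X_n)_{n \geq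 0}$ with $X_0 = \emptyset$ and, for all $n$, $X_n \subseteq X_{n+1}$ and $X_{n+1} \in T^{\mathit{nd}}_Q(X_n)$. - A derivable model of $Q$ is the union $\bigcup_n X_n$ of some $Q$-computation. Reduct and stable models: the reduct $P^M$ is the Horn mca-program obtained from $P$ by (1) removing every clause whose body contains a literal $\mathbf{not}(A)$ with $M \models A$, and (2) removing all literals of the form $\mathbf{not}(A)$ from the remaining clauses. $M$ is a stable model of $P$ if $M$ is a derivable model of $P^M$. -}

module Defs where

open import Data.Nat using (ℕ; zero; suc; _≤_)
open import Data.List using (List; []; _∷_; length)
open import Data.List.Membership.Propositional using (_∈_)
open import Data.List.Relation.Unary.All using (All)
open import Data.List.Relation.Unary.Unique.Propositional using (Unique)
open import Data.Product using (Σ; ∃; _×_; _,_)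
open import Relation.Binary.PropositionalEquality using (_≡_)
open import Relation.Nullary using (¬_)
open import Function.Bundles using (_⇔_)

module _ (At : Set) where

  Interp : Set₁
  Interp = At → Set

  -- mc-atom kX : X a finite set of atoms given as a duplicate-free list, k ≤ |X|
  record McAtom : Set where
    constructor mc
    field
      k      : ℕ
      X      : List At
      uniqX  : Unique X
      k≤∣X∣  : k ≤ length X
  open McAtom public

  aset : McAtom → List At
  aset A = X A

  data McLit : Set where
    pos : McAtom → McLit
    neg : McAtom → McLit

  record Clause : Set where
    constructor _←_
    field
      hd : McAtom
      bd : List McLit
  open Clause public

  Program : Set₁
  Program = Clause → Set

  IsHorn : Program → Set
  IsHorn P = ∀ r → P r → ∀ A → ¬ (neg A ∈ bd r)

  -- M ⊨ kX  iff  |M ∩ X| ≥ k, i.e. there are at least k distinct atoms of X in M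
  _⊨ᵃ_ : Interp → McAtom → Set
  M ⊨ᵃ A = Σ (List At) λ ys → Unique ys × All (_∈ X A) ys × All M ys × k A ≤ length ys

  _⊨ˡ_ : Interp → McLit → Set
  M ⊨ˡ pos A = M ⊨ᵃ A
  M ⊨ˡ neg A = ¬ (M ⊨ᵃ A)

  _⊨ᵇ_ : Interp → List McLit → Set
  M ⊨ᵇ ls = All (M ⊨ˡ_) ls

  activeCl : Program → Interp → Program
  activeCl P M r = P r × M ⊨ᵇ bd r

  inHset : Program → At → Set
  inHset Q a = ∃ λ r → Q r × a ∈ aset (hd r)

  _⊆_ : Interp → Interp → Set
  M ⊆ N = ∀ a → M a → N a

  Tnd : Program → Interp → Interp → Set
  Tnd P M M' = (M' ⊆ inHset (activeCl P M))
             × (∀ r → activeCl P M r → M' ⊨ᵃ hd r)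

  SupportedModel : Program → Interp → Set
  SupportedModel P M = Tnd P M M

  record Computation (Q : Program) : Set₁ where
    field
      Xs     : ℕ → Interp
      empty  : ∀ a → ¬ Xs zero a
      mono   : ∀ n → Xs n ⊆ Xs (suc n)
      step   : ∀ n → Tnd Q (Xs n) (Xs (suc n))

  DerivableModel : Program → Interp → Set₁
  DerivableModel Q M = Σ (Computation Q) λ c →
    ∀ a → M a ⇔ (∃ λ n → Computation.Xs c n a)

  posPart : List McLit → List McLit
  posPart []           = []
  posPart (pos A ∷ ls) = pos A ∷ posPart ls
  posPart (neg A ∷ ls) = posPart ls

  reduct : Program → Interp → Program
  reduct P M r' = ∃ λ r → P r
                        × (∀ A → neg A ∈ bd r → ¬ (M ⊨ᵃ A))
                        × r' ≡ (hd r ← posPart (bd r))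

  StableModel : Program → Interp → Set₁
  StableModel P M = DerivableModel (reduct P M) M

{-# OPTIONS --safe #-}
module Submission where

-- A stable model M is the union of a computation X₀ ⊆ X₁ ⊆ … of the reduct P^M.
-- Every atom of M enters at some step n + 1 as a head atom of a clause of P^M
-- whose body holds in Xₙ ⊆ M; the clause of P it comes from then has its body
-- true in M, because P^M only keeps clauses whose negative literals are false in M.
-- Conversely, if a clause of P has its body true in M, the positive part of that
-- body is finite, so it already holds at some stage Xₙ; the reduct clause then
-- fires, and its head holds in Xₙ₊₁ ⊆ M.

open import Defs
open import Data.Nat using (ℕ; zero; suc; _≤_; _⊔_; _≤′_; ≤′-refl; ≤′-step)
open import Data.Nat.Properties using (m≤m⊔n; m≤n⊔m; ≤⇒≤′)
open import Data.List using (List; []; _∷_)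
open import Data.List.Membership.Propositional using (_∈_)
open import Data.List.Relation.Unary.All as All using (All; []; _∷_)
open import Data.List.Relation.Unary.Any using (here; there)
open import Data.Product using (∃; _×_; _,_; proj₁; proj₂)
open import Data.Empty using (⊥-elim)
open import Relation.Nullary using (¬_)
open import Relation.Binary.PropositionalEquality using (refl)
open import Function.Bundles using (Equivalence)

module _ {At : Set} where

  private
    _⊨_ : Interp At → McAtom At → Set
    _⊨_ = _⊨ᵃ_ At

    _⊨*_ : Interp At → List (McLit At) → Set
    _⊨*_ = _⊨ᵇ_ At

    _⊑_ : Interp At → Interp At → Set
    _⊑_ = _⊆_ At

  NegationFree : List (McLit At) → Set
  NegationFree ls = ∀ A → ¬ (neg A ∈ ls)

  NegationFree-tail : ∀ {A ls} → NegationFree (pos A ∷ ls) → NegationFree ls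
  NegationFree-tail nf A i = nf A (there i)

  posPart-negationFree : ∀ ls → NegationFree (posPart At ls)
  posPart-negationFree (pos A ∷ ls) B (there i) = posPart-negationFree ls B i
  posPart-negationFree (neg A ∷ ls) B i         = posPart-negationFree ls B i

  ⊨-mono : ∀ {M N A} → M ⊑ N → M ⊨ A → N ⊨ A
  ⊨-mono M⊑N (ys , uniq , ys⊆X , ys⊆M , k≤) =
    ys , uniq , ys⊆X , All.map (λ {a} → M⊑N a) ys⊆M , k≤

  ⊨*-mono : ∀ {M N ls} → NegationFree ls → M ⊑ N → M ⊨* ls → N ⊨* ls
  ⊨*-mono {ls = []}         nf M⊑N []       = []
  ⊨*-mono {ls = pos A ∷ ls} nf M⊑N (p ∷ ps) =
    ⊨-mono {A = A} M⊑N p ∷ ⊨*-mono (NegationFree-tail nf) M⊑N ps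
  ⊨*-mono {ls = neg A ∷ ls} nf M⊑N _        = ⊥-elim (nf A (here refl))

  ⊨*-posPart : ∀ {M} ls → M ⊨* ls → M ⊨* posPart At ls
  ⊨*-posPart []           []       = []
  ⊨*-posPart (pos A ∷ ls) (p ∷ ps) = p ∷ ⊨*-posPart ls ps
  ⊨*-posPart (neg A ∷ ls) (_ ∷ ps) = ⊨*-posPart ls ps

  posPart-⊨*⇒⊨* : ∀ {S M} ls → S ⊑ M → (∀ A → neg A ∈ ls → ¬ (M ⊨ A)) →
                  S ⊨* posPart At ls → M ⊨* ls
  posPart-⊨*⇒⊨* []           S⊑M negs []       = []
  posPart-⊨*⇒⊨* (pos A ∷ ls) S⊑M negs (p ∷ ps) =
    ⊨-mono {A = A} S⊑M p ∷ posPart-⊨*⇒⊨* ls S⊑M (λ B i → negs B (there i)) ps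
  posPart-⊨*⇒⊨* (neg A ∷ ls) S⊑M negs ps       =
    negs A (here refl) ∷ posPart-⊨*⇒⊨* ls S⊑M (λ B i → negs B (there i)) ps

  module Chain (Xs : ℕ → Interp At) (step-⊑ : ∀ n → Xs n ⊑ Xs (suc n)) where

    ⋃ : Interp At
    ⋃ a = ∃ λ n → Xs n a

    Xs-mono : ∀ {m n} → m ≤ n → Xs m ⊑ Xs n
    Xs-mono m≤n = go (≤⇒≤′ m≤n)
      where
      go : ∀ {m n} → m ≤′ n → Xs m ⊑ Xs n
      go ≤′-refl         a x = x
      go (≤′-step {n} p) a x = step-⊑ n a (go p a x)

    All-⋃⇒stage : ∀ {ys} → All ⋃ ys → ∃ λ n → All (Xs n) ys
    All-⋃⇒stage []              = 0 , []
    All-⋃⇒stage ((m , y) ∷ ys) with All-⋃⇒stage ys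
    ... | n , ys⊆Xsn =
      m ⊔ n , Xs-mono (m≤m⊔n m n) _ y ∷ All.map (Xs-mono (m≤n⊔m m n) _) ys⊆Xsn

    ⊨-⋃⇒stage : ∀ {A} → ⋃ ⊨ A → ∃ λ n → Xs n ⊨ A
    ⊨-⋃⇒stage (ys , uniq , ys⊆X , ys⊆⋃ , k≤) with All-⋃⇒stage ys⊆⋃
    ... | n , ys⊆Xsn = n , ys , uniq , ys⊆X , ys⊆Xsn , k≤

    ⊨*-⋃⇒stage : ∀ {ls} → NegationFree ls → ⋃ ⊨* ls → ∃ λ n → Xs n ⊨* ls
    ⊨*-⋃⇒stage {[]}         nf []       = 0 , []
    ⊨*-⋃⇒stage {neg A ∷ ls} nf _        = ⊥-elim (nf A (here refl))
    ⊨*-⋃⇒stage {pos A ∷ ls} nf (p ∷ ps)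
      with ⊨-⋃⇒stage {A} p | ⊨*-⋃⇒stage (NegationFree-tail nf) ps
    ... | m , q | n , qs =
      m ⊔ n , ⊨-mono {A = A} (Xs-mono (m≤m⊔n m n)) q
            ∷ ⊨*-mono (NegationFree-tail nf) (Xs-mono (m≤n⊔m m n)) qs

  module _ {Q : Program At} {M : Interp At} (derivable : DerivableModel At Q M) where
    open Computation (proj₁ derivable)
    open Chain Xs mono

    private
      M⊑⋃ : M ⊑ ⋃
      M⊑⋃ a = Equivalence.to (proj₂ derivable a)

      Xs⊑M : ∀ n → Xs n ⊑ M
      Xs⊑M n a x = Equivalence.from (proj₂ derivable a) (n , x)

    derivable⇒head-support : ∀ a → M a →
                             ∃ λ S → S ⊑ M × inHset At (activeCl At Q S) a
    derivable⇒head-support a Ma with M⊑⋃ a Ma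
    ... | zero  , x = ⊥-elim (empty a x)
    ... | suc n , x = Xs n , Xs⊑M n , proj₁ (step n) a x

    derivable⇒model : IsHorn At Q → ∀ r → Q r → M ⊨* bd r → M ⊨ hd r
    derivable⇒model horn r Qr M⊨bd
      with ⊨*-⋃⇒stage (horn r Qr) (⊨*-mono (horn r Qr) M⊑⋃ M⊨bd)
    ... | n , Xsn⊨bd = ⊨-mono {A = hd r} (Xs⊑M (suc n)) (proj₂ (step n) r (Qr , Xsn⊨bd))

  module _ {P : Program At} {M : Interp At} where

    reduct-horn : IsHorn At (reduct At P M)
    reduct-horn _ (r , _ , _ , refl) = posPart-negationFree (bd r)

    active⇒reduct : ∀ {r} → activeCl At P M r → reduct At P M (hd r ← posPart At (bd r))
    active⇒reduct {r} (Pr , M⊨bd) = r , Pr , (λ A i → All.lookup M⊨bd i) , refl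

    reduct-hset⊆hset : ∀ {S} → S ⊑ M →
                       inHset At (activeCl At (reduct At P M) S) ⊑ inHset At (activeCl At P M)
    reduct-hset⊆hset S⊑M a (_ , ((r , Pr , negs , refl) , S⊨bd) , a∈hd) =
      r , (Pr , posPart-⊨*⇒⊨* (bd r) S⊑M negs S⊨bd) , a∈hd

proposition7 : (At : Set) (P : Program At) (M : Interp At) →
    StableModel At P M → SupportedModel At P M
proposition7 At P M stable = heads-supported , heads-hold
  where
  heads-supported : _⊆_ At M (inHset At (activeCl At P M))
  heads-supported a Ma with derivable⇒head-support stable a Ma
  ... | S , S⊑M , a∈hset = reduct-hset⊆hset S⊑M a a∈hset

  heads-hold : ∀ r → activeCl At P M r → _⊨ᵃ_ At M (hd r)
  heads-hold r active@(_ , M⊨bd) =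
    derivable⇒model stable reduct-horn _ (active⇒reduct active) (⊨*-posPart (bd r) M⊨bd)
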